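{- Let $D=(\mathcal R,N,S,P)$ be an SLP, $A\in N$, and let $U$ be a top-level $A$-subset of $\mathsf{val}(D)$. Then there is no nonterminal $B\in N$ with $B\neq A$ such that $U$ is a top-level $B$-subset.
   Context: SLP: $D=(\mathcal R,N,S,P)$ with nonterminals $A\in N$ of rank $\mathsf{rank}(A)$, $\mathsf{rank}(S)=0$, one production $A\to(\mathcal U_A,\tau_A,E_A)$ per $A$, where $\mathcal U_A$ is a finite relational structure, $\tau_A:[\mathsf{rank}(A)]\to\mathcal U_A$ is injective (contact nodes $\mathrm{ran}(\tau_A)$) and $E_A$ is a multiset of references $(B,\sigma)$ with $\sigma:[\mathsf{rank}(B)]\to\mathcal U_A$ injective; the reference relation is acyclic. $\mathsf{val}(A)$ is obtained (bottom-up) from the disjoint union of $\mathcal U_A$ and copies of $\mathsf{val}(B)$ for each $(B,\sigma)\in E_A$ by identifying $\sigma(j)$ with the $j$-th contact node of $\mathsf{val}(B)$; $\mathsf{val}(D)=\mathsf{val}(S)$. $\mathsf{dag}(D)$ has node set $N$ and edges $(A,i,B_i)$ for a fixed enumeration $(B_1,\sigma_1),\ldots,(B_n,\sigma_n)$ of $E_A$; paths are written $v_0i_1v_1\cdots i_nv_n$. Each node of $\mathsf{val}(D)$ is identified with its unique $D$-representation $(p,v)$: either $p=S$ and $v\in\mathcal U_S$, or $p$ is an $S$-path ending in $B\ne S$ and $v\in\mathcal U_B\setminus\mathrm{ran}(\tau_B)$. A node $(p,v)$ of $\mathsf{val}(D)$ is $A$-produced if $p$ contains $A$; its $A$-origin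 is the unique prefix of $p$ that is an $S$-to-$A$ path. It is top-level $A$-produced if $p$ ends in $A$. A subset $U\subseteq\mathsf{val}(D)$ is an $A$-subset if all its nodes are $A$-produced with the same $A$-origin; it is a top-level $A$-subset if moreover at least one node of $U$ is top-level $A$-produced. -}

module Defs where

open import Data.Nat using (ℕ)
open import Data.Fin using (Fin)
open import Data.List using (List; length; lookup)
open import Data.Vec using (Vec)
open import Data.Product using (Σ; _×_; ∃)
open import Relation.Binary.PropositionalEquality using (_≡_; _≢_)
open import Function.Definitions using (Injective)
open import Data.Empty using (⊥)

record Signature : Set₁ where
  field
    Sym : Set
    ar  : Sym → ℕ
open Signature public

-- A reference (B , σ) inside the right-hand side of a production whose
-- universe is Fin n; σ : [rank B] → U_A is injective.
record Ref (nt : ℕ) (rank : Fin nt → ℕ) (n : ℕ) : Set where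
  field
    tgt   : Fin nt
    σ     : Fin (rank tgt) → Fin n
    σ-inj : Injective _≡_ _≡_ σ
open Ref public

data Walk {nt : ℕ} (deg : Fin nt → ℕ) (tgtOf : (A : Fin nt) → Fin (deg A) → Fin nt)
          : Fin nt → Fin nt → Set where
  nil  : ∀ {A} → Walk deg tgtOf A A
  step : ∀ {A C} (i : Fin (deg A)) → Walk deg tgtOf (tgtOf A i) C → Walk deg tgtOf A C

-- Nonterminals are N = Fin nt; the finite structure U_A has universe Fin (size A)
-- and, for each relation symbol r, the finite list of tuples in r.
-- E A is the multiset of references, listed in a fixed enumeration (B_1,σ_1),...,(B_n,σ_n).
record SLP (R : Signature) : Set where
  field
    nt     : ℕ
    S      : Fin nt
    rank   : Fin nt → ℕ
    rankS  : rank S ≡ 0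
    size   : Fin nt → ℕ
    rel    : (A : Fin nt) (r : Sym R) → List (Vec (Fin (size A)) (ar R r))
    τ      : (A : Fin nt) → Fin (rank A) → Fin (size A)
    τ-inj  : (A : Fin nt) → Injective _≡_ _≡_ (τ A)
    E      : (A : Fin nt) → List (Ref nt rank (size A))
    -- the reference relation is acyclic: no cycle A -> ... -> A in dag(D)
    acyclic : (A : Fin nt) (i : Fin (length (E A))) →
              Walk (λ X → length (E X)) (λ X j → tgt (lookup (E X) j)) (tgt (lookup (E A) i)) A → ⊥

module _ {R : Signature} (D : SLP R) where
  open SLP D

  deg : Fin nt → ℕ
  deg A = length (E A)

  edgeTgt : (A : Fin nt) → Fin (deg A) → Fin nt
  edgeTgt A i = tgt (lookup (E A) i)

  data SPath : Fin nt → Set where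
    start : SPath S
    ext   : ∀ {A} → SPath A → (i : Fin (deg A)) → SPath (edgeTgt A i)

  data _≼_ : ∀ {A B} → SPath A → SPath B → Set where
    ≼-refl : ∀ {A} {p : SPath A} → p ≼ p
    ≼-ext  : ∀ {A B} {q : SPath A} {p : SPath B} (i : Fin (deg B)) → q ≼ p → q ≼ ext p i

  -- D-representations (p , v) = nodes of val(D)
  data NodeCond : (B : Fin nt) → SPath B → Fin (size B) → Set where
    atS   : (v : Fin (size S)) → NodeCond S start v
    inner : ∀ {B} (p : SPath B) (v : Fin (size B)) →
            B ≢ S → ((j : Fin (rank B)) → τ B j ≢ v) → NodeCond B p v

  record Node : Set where
    constructor node
    field
      last : Fin nt
      path : SPath last
      vtx  : Fin (size last)
      ok   : NodeCond last path vtx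
  open Node public

  IsOrigin : (A : Fin nt) → Node → SPath A → Set
  IsOrigin A u q = q ≼ path u

  -- u is A-produced: its path contains A
  Produced : Fin nt → Node → Set
  Produced A u = Σ (SPath A) (IsOrigin A u)

  TopLevel : Fin nt → Node → Set
  TopLevel A u = last u ≡ A

  IsSubsetOf : Fin nt → (Node → Set) → Set
  IsSubsetOf A U = Σ (SPath A) λ q → (u : Node) → U u → IsOrigin A u q

  IsTopSubsetOf : Fin nt → (Node → Set) → Set
  IsTopSubsetOf A U = IsSubsetOf A U × Σ Node λ u → U u × TopLevel A u

{-# OPTIONS --safe #-}
-- A prefix q ≼ p of S-paths, with q ending in X and p in Y, is a walk from X to Y in
-- dag(D). If U is a top-level A-subset and a top-level B-subset, a node of U whose path
-- ends in A has a B-origin, so B reaches A; symmetrically A reaches B. Since dag(D) is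
-- acyclic, mutual reachability forces A = B.
module Submission where

open import Defs
open import Data.Fin using (Fin)
open import Data.Product using (Σ; _×_; _,_)
open import Data.Empty using (⊥-elim)
open import Relation.Binary.PropositionalEquality using (_≡_; _≢_; refl)
open import Relation.Nullary using (¬_)

module _ {R : Signature} (D : SLP R) where
  open SLP D

  DagWalk : Fin nt → Fin nt → Set
  DagWalk = Walk (deg D) (edgeTgt D)

  walk-snoc : ∀ {X Y} → DagWalk X Y → (i : Fin (deg D Y)) → DagWalk X (edgeTgt D Y i)
  walk-snoc nil        i = step i nil
  walk-snoc (step j w) i = step j (walk-snoc w i)

  walk-++ : ∀ {X Y Z} → DagWalk X Y → DagWalk Y Z → DagWalk X Z
  walk-++ nil        v = v
  walk-++ (step j w) v = step j (walk-++ w v)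

  ≼⇒walk : ∀ {X Y} {q : SPath D X} {p : SPath D Y} → _≼_ D q p → DagWalk X Y
  ≼⇒walk ≼-refl      = nil
  ≼⇒walk (≼-ext i h) = walk-snoc (≼⇒walk h) i

  walk-antisym : ∀ {X Y} → DagWalk X Y → DagWalk Y X → X ≡ Y
  walk-antisym nil        _ = refl
  walk-antisym (step i w) v = ⊥-elim (acyclic _ i (walk-++ w v))

  subset-origin-reaches : ∀ {A B U} → IsSubsetOf D B U →
                          (u : Node D) → U u → TopLevel D A u → DagWalk B A
  subset-origin-reaches (_ , origin) u Uu refl = ≼⇒walk (origin u Uu)

lemma15 : {R : Signature} (D : SLP R) (A : Fin (SLP.nt D)) (U : Node D → Set) →
    IsTopSubsetOf D A U →
    ¬ (Σ (Fin (SLP.nt D)) λ B → B ≢ A × IsTopSubsetOf D B U)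
lemma15 D A U (subsetA , u , Uu , topA) (B , B≢A , subsetB , w , Uw , topB) =
  B≢A (walk-antisym D (subset-origin-reaches D subsetB u Uu topA)
                      (subset-origin-reaches D subsetA w Uw topB))
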